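{- Let $m\ge0$ be an integer and let \[\theta(x)=\sum_{n=0}^{\infty}\frac{(n+1)(m+1)}{(n+m+1)(2m+1)}\,\mathcal{C}_{n+m+1,m}\,x^n.\] Then, as formal power series, $\theta(x)=\gamma_m(x)\gamma_0(x)=\gamma_m(x)\,\frac{1-\sqrt{1-4x}}{2x}$.
   Context: A path is a finite sequence of points of $\mathbb{Z}^2$ in which each step is $(1,0)$ or $(0,1)$. For integers $0\le m\le n$, $\mathcal{C}_{n,m}$ denotes the number of paths from $(0,-2m)$ to $(n-m,n-m)$ not crossing the line $y=x$, i.e. all of whose points $(p,q)$ satisfy $q\le p$. For $m\ge0$, $\gamma_m(x)=\sum_{n\ge0}\mathcal{C}_{n+m,m}x^n$; in particular $\gamma_0(x)=\frac{1-\sqrt{1-4x}}{2x}$, with $\sqrt{1-4x}$ the formal power series with constant term $1$ squaring to $1-4x$. -}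

module Defs where

open import Data.Bool using (Bool; true; false)
open import Data.Nat as ℕ using (ℕ; zero; suc)
open import Data.Integer as ℤ using (ℤ; +_)
open import Data.Rational as ℚ using (ℚ; 0ℚ; 1ℚ)
open import Data.Product using (_×_; _,_; proj₁; proj₂)
open import Data.List using (List; []; _∷_; map; _++_; length; filter; last; concatMap)
open import Data.List.Relation.Unary.All as All using (All)
open import Data.Maybe using (Maybe; just; nothing)
open import Relation.Binary.PropositionalEquality using (_≡_)
open import Relation.Nullary using (Dec; yes; no)
open import Relation.Nullary.Decidable using (_×-dec_)
open import Relation.Unary using (Decidable)

-- A step: true = (1,0), false = (0,1).
Step : Set
Step = Bool

Point : Set
Point = ℤ × ℤ

move : Point → Step → Point
move (p , q) true  = (p ℤ.+ + 1 , q)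
move (p , q) false = (p , q ℤ.+ + 1)

points : Point → List Step → List Point
points s []       = s ∷ []
points s (d ∷ ds) = s ∷ points (move s d) ds

endpoint : Point → List Step → Point
endpoint s []       = s
endpoint s (d ∷ ds) = endpoint (move s d) ds

stepSeqs : ℕ → List (List Step)
stepSeqs zero    = [] ∷ []
stepSeqs (suc k) = map (true ∷_) (stepSeqs k) ++ map (false ∷_) (stepSeqs k)

Below : Point → Set
Below (p , q) = q ℤ.≤ p

below? : Decidable Below
below? (p , q) = q ℤ.≤? p

_≟P_ : (a b : Point) → Dec (a ≡ b)
(p , q) ≟P (p' , q') with p ℤ.≟ p' | q ℤ.≟ q'
... | yes Relation.Binary.PropositionalEquality.refl | yes Relation.Binary.PropositionalEquality.refl = yes Relation.Binary.PropositionalEquality.refl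
... | no ne | _ = no λ { Relation.Binary.PropositionalEquality.refl → ne Relation.Binary.PropositionalEquality.refl }
... | _ | no ne = no λ { Relation.Binary.PropositionalEquality.refl → ne Relation.Binary.PropositionalEquality.refl }

GoodPath : Point → Point → List Step → Set
GoodPath s t ds = (endpoint s ds ≡ t) × All Below (points s ds)

goodPath? : (s t : Point) → Decidable (GoodPath s t)
goodPath? s t ds = (endpoint s ds ≟P t) ×-dec All.all? below? (points s ds)

-- 𝒞 n m : number of paths from (0,-2m) to (n-m,n-m) not crossing y = x.
-- Any such path has exactly (n-m) + (n+m) = 2n steps, so it suffices to
-- enumerate all step sequences of length 2n.
𝒞 : ℕ → ℕ → ℕ
𝒞 n m = length (filter (goodPath? start target) (stepSeqs (2 ℕ.* n)))
  where
  start  = (+ 0 , ℤ.- (+ (2 ℕ.* m)))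
  target = (+ n ℤ.- + m , + n ℤ.- + m)

natℚ : ℕ → ℚ
natℚ n = (+ n) ℚ./ 1

Series : Set
Series = ℕ → ℚ

_≈S_ : Series → Series → Set
f ≈S g = ∀ n → f n ≡ g n

sumTo : ℕ → (ℕ → ℚ) → ℚ
sumTo zero    f = f 0
sumTo (suc n) f = sumTo n f ℚ.+ f (suc n)

_*S_ : Series → Series → Series
(f *S g) n = sumTo n (λ k → f k ℚ.* g (n ℕ.∸ k))

_-S_ : Series → Series → Series
(f -S g) n = f n ℚ.- g n

constS : ℚ → Series
constS c zero    = c
constS c (suc n) = 0ℚ

mulCX : ℚ → Series → Series
mulCX c f zero    = 0ℚ
mulCX c f (suc n) = c ℚ.* f n

oneMinus4x : Series
oneMinus4x zero          = 1ℚ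
oneMinus4x (suc zero)    = ℚ.- (natℚ 4)
oneMinus4x (suc (suc n)) = 0ℚ

γ : ℕ → Series
γ m n = natℚ (𝒞 (n ℕ.+ m) m)

θ : ℕ → Series
θ m n = (+ (suc n ℕ.* suc m)) ℚ./ (suc (n ℕ.+ m) ℕ.* suc (2 ℕ.* m))
        ℚ.* natℚ (𝒞 (n ℕ.+ m ℕ.+ 1) m)

{-# OPTIONS --safe #-}
-- Write c = γ₀ for the Catalan series, so c = 1 + x c².  Recording a path by its height p − q,
-- 𝒞_{n+m,m} counts walks with steps ±1 from height 2m down to 0 that never go below 0, and
-- these are the coefficients of c^{2m+1}; so γ_m = c^{2m+1}.  The ballot formula
-- (2n+r)·[xⁿ]c^r = r·binom(2n+r, n) shows that the weight in θ is exactly the ratio between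
-- [xⁿ⁺¹]c^{2m+1} and [xⁿ]c^{2m+2}, so θ = c^{2m+2} = γ_m γ₀.  For the second identity, a series
-- s with s(0) = 1 and s² = 1 − 4x is determined coefficient by coefficient, and 1 − 2xc is such
-- a series, so 2xθ = 2x γ_m c = γ_m (1 − s).
module Submission where

open import Defs
open import Algebra.Bundles using (CommutativeMonoid)
import Algebra.Properties.CommutativeSemigroup as CommSemigroupProperties
open import Data.Bool using (true; false)
open import Data.List using ([]; _∷_; _++_; map; length; filter)
open import Data.List.Properties using (length-++; filter-++; filter-none; filter-accept; filter-reject; filter-≐)
import Data.List.Relation.Unary.All as All
open import Data.Nat as ℕ using (ℕ; zero; suc; _+_; _*_; _∸_; _≤_; _<_; z≤n; s≤s)
open import Data.Nat.Combinatorics using (_C_; nC1≡n; nCk+nC[k+1]≡[n+1]C[k+1])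
open import Data.Nat.Properties
  using ( +-assoc; +-comm; +-suc; +-identityʳ; *-identityʳ; *-zeroʳ; *-distribˡ-+; *-commutativeSemigroup
        ; +-cancelʳ-≡; *-cancelˡ-≡; ≤-refl; ≤-reflexive; ≤-pred; m≤n⇒m≤1+n; m<n⇒m<1+n; m≤n⇒m<n∨m≡n
        ; +-∸-assoc; n∸n≡0; m∸n≤m )
open import Data.Nat.Tactic.RingSolver renaming (solve to ℕ-solve; solve-∀ to ℕ-solve-∀)
open import Data.Integer as ℤ using (ℤ; +_; -[1+_]; 0ℤ; 1ℤ)
import Data.Integer.Properties as ℤP
open import Data.Integer.Tactic.RingSolver renaming (solve to ℤ-solve; solve-∀ to ℤ-solve-∀)
open import Data.Rational as ℚ using (ℚ; 0ℚ; 1ℚ)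
import Data.Rational.Properties as ℚP
open import Data.Rational.Solver using (module +-*-Solver)
open import Data.Rational.Unnormalised as ℚᵘ using (mkℚᵘ; *≡*) renaming (_≃_ to _≃ᵘ_)
import Data.Rational.Unnormalised.Properties as ℚᵘP
open import Data.Product using (_×_; _,_; proj₁)
open import Data.Sum using (inj₁; inj₂)
open import Function using (_∘_)
open import Relation.Binary.PropositionalEquality
open import Relation.Nullary using (¬_; does)
open import Relation.Unary using (Pred; Decidable)

-- Binomial coefficients and ballot numbers

C-absorption : ∀ n k → suc k * (suc n C suc k) ≡ suc n * (n C k)
C-absorption zero    zero    = refl
C-absorption zero    (suc k) = *-zeroʳ (suc (suc k))
C-absorption (suc n) zero    = begin
  suc (suc n) C 1 + 0  ≡⟨ +-identityʳ _ ⟩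
  suc (suc n) C 1      ≡⟨ nC1≡n (suc (suc n)) ⟩
  suc (suc n)          ≡⟨ *-identityʳ (suc (suc n)) ⟨
  suc (suc n) * 1      ∎
  where open ≡-Reasoning
C-absorption (suc n) (suc k) = begin
  suc (suc k) * (suc (suc n) C suc (suc k))    ≡⟨ cong (suc (suc k) *_) (nCk+nC[k+1]≡[n+1]C[k+1] (suc n) (suc k)) ⟨
  suc (suc k) * (X + Y)                        ≡⟨ *-distribˡ-+ (suc (suc k)) X Y ⟩
  (X + suc k * X) + suc (suc k) * Y            ≡⟨ +-assoc X _ _ ⟩
  X + (suc k * X + suc (suc k) * Y)            ≡⟨ cong (λ x → X + x) (cong₂ _+_ (C-absorption n k) (C-absorption n (suc k))) ⟩
  X + (suc n * (n C k) + suc n * (n C suc k))  ≡⟨ cong (λ x → X + x) (*-distribˡ-+ (suc n) (n C k) _) ⟨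
  X + suc n * (n C k + n C suc k)              ≡⟨ cong (λ Z → X + suc n * Z) (nCk+nC[k+1]≡[n+1]C[k+1] n k) ⟩
  suc (suc n) * X                              ∎
  where
  open ≡-Reasoning
  X = suc n C suc k
  Y = suc n C suc (suc k)

C-suc-ratio : ∀ {N} k j → N ≡ k + j → suc k * (N C suc k) ≡ j * (N C k)
C-suc-ratio zero j refl = begin
  j C 1 + 0  ≡⟨ +-identityʳ _ ⟩
  j C 1      ≡⟨ nC1≡n j ⟩
  j          ≡⟨ *-identityʳ j ⟨
  j * 1      ∎
  where open ≡-Reasoning
C-suc-ratio (suc k) j refl = *-cancelˡ-≡ _ _ (suc k) (begin
  suc k * (suc (suc k) * (suc M C suc (suc k)))  ≡⟨ cong (suc k *_) (C-absorption M (suc k)) ⟩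
  suc k * (suc M * (M C suc k))                  ≡⟨ x∙yz≈y∙xz (suc k) (suc M) _ ⟩
  suc M * (suc k * (M C suc k))                  ≡⟨ cong (suc M *_) (C-suc-ratio k j refl) ⟩
  suc M * (j * (M C k))                          ≡⟨ x∙yz≈y∙xz (suc M) j _ ⟩
  j * (suc M * (M C k))                          ≡⟨ cong (j *_) (C-absorption M k) ⟨
  j * (suc k * (suc M C suc k))                  ≡⟨ x∙yz≈y∙xz j (suc k) _ ⟩
  suc k * (j * (suc M C suc k))                  ∎)
  where
  open ≡-Reasoning
  open CommSemigroupProperties *-commutativeSemigroup using (x∙yz≈y∙xz)
  M = k + j

-- ballot r n = [xⁿ] cʳ for the Catalan series c = 1 + x c²; the recurrence is
-- c^{r+1} = c^r + x c^{r+2} read off at xⁿ⁺¹.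
ballot : ℕ → ℕ → ℕ
ballot zero    zero    = 1
ballot zero    (suc n) = 0
ballot (suc r) zero    = 1
ballot (suc r) (suc n) = ballot r (suc n) + ballot (suc (suc r)) n

ballot-zero : ∀ r → ballot r 0 ≡ 1
ballot-zero zero    = refl
ballot-zero (suc r) = refl

ballot-binomial : ∀ r n {N} → N ≡ n + n + r → N * ballot r n ≡ r * (N C n)
ballot-binomial zero    zero    refl = refl
ballot-binomial zero    (suc n) refl = *-zeroʳ (suc n + suc n + 0)
ballot-binomial (suc r) zero    refl = refl
ballot-binomial (suc r) (suc n) {N} refl = *-cancelˡ-≡ _ _ N′ (begin
  N′ * (N * (a₁ + a₂))                  ≡⟨ cong (λ M → N′ * (M * (a₁ + a₂))) N≡1+N′ ⟩
  N′ * (suc N′ * (a₁ + a₂))             ≡⟨ x∙yz≈y∙xz N′ (suc N′) (a₁ + a₂) ⟩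
  suc N′ * (N′ * (a₁ + a₂))             ≡⟨ cong (suc N′ *_) (*-distribˡ-+ N′ a₁ a₂) ⟩
  suc N′ * (N′ * a₁ + N′ * a₂)          ≡⟨ cong (suc N′ *_) (cong₂ _+_ (ballot-binomial r (suc n) refl)
                                                                        (ballot-binomial (suc (suc r)) n N′≡)) ⟩
  suc N′ * (r * b₁ + suc (suc r) * b₀)  ≡⟨ +-cancelʳ-≡ _ _ _ balance ⟩
  N′ * (suc r * (b₀ + b₁))              ≡⟨ cong (λ b → N′ * (suc r * b)) (nCk+nC[k+1]≡[n+1]C[k+1] N′ n) ⟩
  N′ * (suc r * (suc N′ C suc n))       ≡⟨ cong (λ M → N′ * (suc r * (M C suc n))) N≡1+N′ ⟨
  N′ * (suc r * (N C suc n))            ∎)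
  where
  open ≡-Reasoning
  open CommSemigroupProperties *-commutativeSemigroup using (x∙yz≈y∙xz)
  N′ = suc n + suc n + r
  a₁ = ballot r (suc n)
  a₂ = ballot (suc (suc r)) n
  b₀ = N′ C n
  b₁ = N′ C suc n
  N′≡ : suc n + suc n + r ≡ n + n + suc (suc r)
  N′≡ = ℕ-solve (n ∷ r ∷ [])
  N≡1+N′ : suc n + suc n + suc r ≡ suc (suc n + suc n + r)
  N≡1+N′ = ℕ-solve (n ∷ r ∷ [])
  N′-split : suc n + suc n + r ≡ n + (n + suc (suc r))
  N′-split = ℕ-solve (n ∷ r ∷ [])
  -- The step's identity with both sides moved so that no subtraction occurs; the two added
  -- terms agree by C-suc-ratio.
  balance-identity : ∀ n r b₀ b₁ →
    suc (suc n + suc n + r) * (r * b₁ + suc (suc r) * b₀) + 2 * (suc n * b₁)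
      ≡ (suc n + suc n + r) * (suc r * (b₀ + b₁)) + 2 * ((n + suc (suc r)) * b₀)
  balance-identity = ℕ-solve-∀
  balance : suc N′ * (r * b₁ + suc (suc r) * b₀) + 2 * (suc n * b₁)
              ≡ N′ * (suc r * (b₀ + b₁)) + 2 * (suc n * b₁)
  balance = trans (balance-identity n r b₀ b₁)
                  (cong (λ b → N′ * (suc r * (b₀ + b₁)) + 2 * b)
                        (sym (C-suc-ratio n (n + suc (suc r)) N′-split)))

ballot-ratio : ∀ r n → suc n * (suc r * ballot r (suc n)) ≡ r * ((n + n + suc r) * ballot (suc r) n)
ballot-ratio r n = cross-multiply (ballot-binomial r (suc n) {suc (n + n + suc r)} (ℕ-solve (n ∷ r ∷ [])))
                                  (ballot-binomial (suc r) n refl)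
                                  (C-absorption (n + n + suc r) n)
  where
  open ≡-Reasoning
  cross-multiply : ∀ {a a′ b b′} →
    suc (n + n + suc r) * a ≡ r * b → (n + n + suc r) * a′ ≡ suc r * b′ →
    suc n * b ≡ suc (n + n + suc r) * b′ → suc n * (suc r * a) ≡ r * ((n + n + suc r) * a′)
  cross-multiply {a} {a′} {b} {b′} Ya Ya′ absorb = *-cancelˡ-≡ _ _ (suc (n + n + suc r)) (begin
    suc (n + n + suc r) * (suc n * (suc r * a))         ≡⟨ ℕ-solve (n ∷ r ∷ a ∷ []) ⟩
    suc n * (suc r * (suc (n + n + suc r) * a))         ≡⟨ cong (λ x → suc n * (suc r * x)) Ya ⟩
    suc n * (suc r * (r * b))                           ≡⟨ ℕ-solve (n ∷ r ∷ b ∷ []) ⟩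
    r * (suc r * (suc n * b))                           ≡⟨ cong (λ x → r * (suc r * x)) absorb ⟩
    r * (suc r * (suc (n + n + suc r) * b′))            ≡⟨ ℕ-solve (n ∷ r ∷ b′ ∷ []) ⟩
    suc (n + n + suc r) * (r * (suc r * b′))            ≡⟨ cong (λ x → suc (n + n + suc r) * (r * x)) Ya′ ⟨
    suc (n + n + suc r) * (r * ((n + n + suc r) * a′))  ∎)

ballot-ratio-odd : ∀ m n →
  suc n * suc m * ballot (suc (2 * m)) (suc n) ≡ suc (n + m) * suc (2 * m) * ballot (suc (suc (2 * m))) n
ballot-ratio-odd m n = halve (ballot-ratio (suc (2 * m)) n)
  where
  open ≡-Reasoning
  halve : ∀ {a a′} → suc n * (suc (suc (2 * m)) * a) ≡ suc (2 * m) * ((n + n + suc (suc (2 * m))) * a′) →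
          suc n * suc m * a ≡ suc (n + m) * suc (2 * m) * a′
  halve {a} {a′} eq = *-cancelˡ-≡ _ _ 2 (begin
    2 * (suc n * suc m * a)                           ≡⟨ ℕ-solve (n ∷ m ∷ a ∷ []) ⟩
    suc n * (suc (suc (2 * m)) * a)                   ≡⟨ eq ⟩
    suc (2 * m) * ((n + n + suc (suc (2 * m))) * a′)  ≡⟨ ℕ-solve (n ∷ m ∷ a′ ∷ []) ⟩
    2 * (suc (n + m) * suc (2 * m) * a′)              ∎)

-- Counting lattice paths

-- walks h k counts the walks of k steps ±1 from height h to height 0 that never go below 0.
-- A point (p, q) has height p − q, so an east step raises it and a north step lowers it.
-- The suc k clause comes first so that walks (+ h) (suc k) reduces for a variable h.
walks : ℤ → ℕ → ℕ
walks -[1+ _ ] _       = 0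
walks (+ h)     (suc k) = walks (+ suc h) k + walks (+ h ℤ.- 1ℤ) k
walks (+ zero)  zero    = 1
walks (+ suc _) zero    = 0

walks-short : ∀ {h k} → k < h → walks (+ h) k ≡ 0
walks-short {suc h} {zero}  _         = refl
walks-short {suc h} {suc k} (s≤s k<h) = cong₂ _+_ (walks-short (m<n⇒m<1+n (m<n⇒m<1+n k<h))) (walks-short k<h)

walks-ballot : ∀ h n {k} → k ≡ h + (n + n) → walks (+ h) k ≡ ballot (suc h) n
walks-ballot zero    zero    refl = refl
walks-ballot zero    (suc n) refl = trans (+-identityʳ _) (walks-ballot 1 n (+-suc n n))
walks-ballot (suc h) zero    refl =
  cong₂ _+_ (walks-short (s≤s (m≤n⇒m≤1+n (≤-reflexive (+-identityʳ h))))) (walks-ballot h 0 refl)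
walks-ballot (suc h) (suc n) refl =
  trans (cong₂ _+_ (walks-ballot (suc (suc h)) n {h + (suc n + suc n)} (ℕ-solve (h ∷ n ∷ [])))
                   (walks-ballot h (suc n) refl))
        (+-comm (ballot (suc (suc (suc h))) n) (ballot (suc h) (suc n)))

module _ {a b p} {A : Set a} {B : Set b} {P : Pred B p} (P? : Decidable P) (f : A → B) where

  length-filter-map : ∀ xs → length (filter P? (map f xs)) ≡ length (filter (P? ∘ f) xs)
  length-filter-map []       = refl
  length-filter-map (x ∷ xs) with does (P? (f x))
  ... | true  = cong suc (length-filter-map xs)
  ... | false = length-filter-map xs

count : Point → Point → ℕ → ℕ
count s t k = length (filter (goodPath? s t) (stepSeqs k))

good⇒below : ∀ {s t} ds → GoodPath s t ds → Below s
good⇒below []      (_ , below) = All.head below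
good⇒below (_ ∷ _) (_ , below) = All.head below

count-unbelow : ∀ {s t} k → ¬ Below s → count s t k ≡ 0
count-unbelow {s} {t} k ¬below =
  cong length (filter-none (goodPath? s t) (All.universal (λ ds → ¬below ∘ good⇒below ds) (stepSeqs k)))

count-step : ∀ {s t} k → Below s → count s t (suc k) ≡ count (move s true) t k + count (move s false) t k
count-step {s} {t} k below = begin
  length (filter G (map (true ∷_) S ++ map (false ∷_) S))
    ≡⟨ cong length (filter-++ G (map (true ∷_) S) _) ⟩
  length (filter G (map (true ∷_) S) ++ filter G (map (false ∷_) S))
    ≡⟨ length-++ (filter G (map (true ∷_) S)) ⟩
  length (filter G (map (true ∷_) S)) + length (filter G (map (false ∷_) S))
    ≡⟨ cong₂ _+_ (first-step true) (first-step false) ⟩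
  count (move s true) t k + count (move s false) t k ∎
  where
  open ≡-Reasoning
  G = goodPath? s t
  S = stepSeqs k
  first-step : ∀ d → length (filter G (map (d ∷_) S)) ≡ count (move s d) t k
  first-step d = trans (length-filter-map G (d ∷_) S)
                       (cong length (filter-≐ (G ∘ (d ∷_)) (goodPath? (move s d) t)
                                              ((λ (e , bs) → e , All.tail bs) , (λ (e , bs) → e , below All.∷ bs)) S))

count-accept : ∀ {s t} → GoodPath s t [] → count s t 0 ≡ 1
count-accept {s} {t} good = cong length (filter-accept (goodPath? s t) {x = []} {xs = []} good)

count-reject : ∀ {s t} → ¬ GoodPath s t [] → count s t 0 ≡ 0
count-reject {s} {t} bad = cong length (filter-reject (goodPath? s t) {x = []} {xs = []} bad)

on-diagonal : ∀ {p q a} → p ℤ.+ q ℤ.+ 0ℤ ≡ a ℤ.+ a → p ℤ.- q ≡ 0ℤ → (p , q) ≡ (a , a)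
on-diagonal {p} {q} {a} inv eq = cong₂ _,_ p≡a (trans (sym p≡q) p≡a)
  where
  open ≡-Reasoning
  p≡q : p ≡ q
  p≡q = ℤP.i-j≡0⇒i≡j p q eq
  p≡a : p ≡ a
  p≡a = ℤP.*-cancelˡ-≡ (+ 2) p a (begin
    + 2 ℤ.* p       ≡⟨ ℤ-solve (p ∷ []) ⟩
    p ℤ.+ p ℤ.+ 0ℤ  ≡⟨ cong (λ x → p ℤ.+ x ℤ.+ 0ℤ) p≡q ⟩
    p ℤ.+ q ℤ.+ 0ℤ  ≡⟨ inv ⟩
    a ℤ.+ a         ≡⟨ ℤ-solve (a ∷ []) ⟩
    + 2 ℤ.* a       ∎)

off-diagonal : ∀ {p q a n} → p ℤ.- q ≡ + suc n → (p , q) ≢ (a , a)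
off-diagonal {a = a} eq refl with trans (sym eq) (ℤP.+-inverseʳ a)
... | ()

nonneg⇒below : ∀ {p q n} → p ℤ.- q ≡ + n → Below (p , q)
nonneg⇒below eq = ℤP.0≤i-j⇒j≤i (subst (0ℤ ℤ.≤_) (sym eq) (ℤ.+≤+ z≤n))

negative⇒unbelow : ∀ {p q n} → p ℤ.- q ≡ -[1+ n ] → ¬ Below (p , q)
negative⇒unbelow eq q≤p with subst (0ℤ ℤ.≤_) eq (ℤP.i≤j⇒0≤j-i q≤p)
... | ()

-- Every step raises p + q by one, so the hypothesis puts the end of each k-step path on the
-- antidiagonal through (a, a), where ending at (a, a) means ending at height 0.
count-walks : ∀ k {p q a} → p ℤ.+ q ℤ.+ + k ≡ a ℤ.+ a → count (p , q) (a , a) k ≡ walks (p ℤ.- q) k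
count-walks k {p} {q} {a} inv with p ℤ.- q in eq
count-walks k       {p} {q} {a} inv | -[1+ n ] = count-unbelow {p , q} {a , a} k (negative⇒unbelow eq)
count-walks zero    {p} {q} {a} inv | + zero   =
  count-accept {p , q} {a , a} (on-diagonal inv eq , nonneg⇒below eq All.∷ All.[])
count-walks zero    {p} {q} {a} inv | + suc n  = count-reject {p , q} {a , a} (off-diagonal eq ∘ proj₁)
count-walks (suc k) {p} {q} {a} inv | + n      = begin
  count (p , q) (a , a) (suc k)
    ≡⟨ count-step k (nonneg⇒below eq) ⟩
  count (p ℤ.+ 1ℤ , q) (a , a) k + count (p , q ℤ.+ 1ℤ) (a , a) k
    ≡⟨ cong₂ _+_ (count-walks k inv-east) (count-walks k inv-north) ⟩
  walks (p ℤ.+ 1ℤ ℤ.- q) k + walks (p ℤ.- (q ℤ.+ 1ℤ)) k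
    ≡⟨ cong₂ (λ i j → walks i k + walks j k) east north ⟩
  walks (+ suc n) k + walks (+ n ℤ.- 1ℤ) k
    ∎
  where
  open ≡-Reasoning
  east-shift : ∀ p q k → p ℤ.+ 1ℤ ℤ.+ q ℤ.+ k ≡ p ℤ.+ q ℤ.+ (1ℤ ℤ.+ k)
  east-shift = ℤ-solve-∀
  north-shift : ∀ p q k → p ℤ.+ (q ℤ.+ 1ℤ) ℤ.+ k ≡ p ℤ.+ q ℤ.+ (1ℤ ℤ.+ k)
  north-shift = ℤ-solve-∀
  inv-east : p ℤ.+ 1ℤ ℤ.+ q ℤ.+ + k ≡ a ℤ.+ a
  inv-east = trans (east-shift p q (+ k)) inv
  inv-north : p ℤ.+ (q ℤ.+ 1ℤ) ℤ.+ + k ≡ a ℤ.+ a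
  inv-north = trans (north-shift p q (+ k)) inv
  east : p ℤ.+ 1ℤ ℤ.- q ≡ + suc n
  east = begin
    p ℤ.+ 1ℤ ℤ.- q   ≡⟨ ℤ-solve (p ∷ q ∷ []) ⟩
    1ℤ ℤ.+ (p ℤ.- q) ≡⟨ cong (λ i → 1ℤ ℤ.+ i) eq ⟩
    + suc n          ∎
  north : p ℤ.- (q ℤ.+ 1ℤ) ≡ + n ℤ.- 1ℤ
  north = begin
    p ℤ.- (q ℤ.+ 1ℤ)  ≡⟨ ℤ-solve (p ∷ q ∷ []) ⟩
    p ℤ.- q ℤ.- 1ℤ    ≡⟨ cong (ℤ._- 1ℤ) eq ⟩
    + n ℤ.- 1ℤ        ∎

𝒞-walks : ∀ N m → 𝒞 N m ≡ walks (+ (2 * m)) (2 * N)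
𝒞-walks N m = trans (count-walks (2 * N) start+steps≡2·target) (cong (λ h → walks h (2 * N)) start-height)
  where
  diagonal-sum : ∀ i j → 0ℤ ℤ.+ ℤ.- (+ 2 ℤ.* i) ℤ.+ + 2 ℤ.* j ≡ (j ℤ.- i) ℤ.+ (j ℤ.- i)
  diagonal-sum = ℤ-solve-∀
  start+steps≡2·target : 0ℤ ℤ.+ ℤ.- + (2 * m) ℤ.+ + (2 * N) ≡ (+ N ℤ.- + m) ℤ.+ (+ N ℤ.- + m)
  start+steps≡2·target =
    trans (cong₂ (λ i j → 0ℤ ℤ.+ ℤ.- i ℤ.+ j) (ℤP.pos-* 2 m) (ℤP.pos-* 2 N)) (diagonal-sum (+ m) (+ N))
  start-height : 0ℤ ℤ.- ℤ.- + (2 * m) ≡ + (2 * m)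
  start-height = trans (ℤP.+-identityˡ _) (ℤP.neg-involutive _)

𝒞-ballot : ∀ n m → 𝒞 (n + m) m ≡ ballot (suc (2 * m)) n
𝒞-ballot n m = trans (𝒞-walks (n + m) m) (walks-ballot (2 * m) n {2 * (n + m)} (ℕ-solve (n ∷ m ∷ [])))

-- Formal power series

toℚᵘ-natℚ : ∀ n → ℚ.toℚᵘ (natℚ n) ≃ᵘ mkℚᵘ (+ n) 0
toℚᵘ-natℚ n = ℚP.toℚᵘ-fromℚᵘ (mkℚᵘ (+ n) 0)

natℚ-+ : ∀ a b → natℚ (a + b) ≡ natℚ a ℚ.+ natℚ b
natℚ-+ a b = ℚP.toℚᵘ-injective (begin
  ℚ.toℚᵘ (natℚ (a + b))
    ≈⟨ toℚᵘ-natℚ (a + b) ⟩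
  mkℚᵘ (+ a ℤ.+ + b) 0
    ≈⟨ *≡* (cong (ℤ._* + 1) (cong₂ ℤ._+_ (ℤP.*-identityʳ (+ a)) (ℤP.*-identityʳ (+ b)))) ⟨
  mkℚᵘ (+ a) 0 ℚᵘ.+ mkℚᵘ (+ b) 0
    ≈⟨ ℚᵘP.+-cong (toℚᵘ-natℚ a) (toℚᵘ-natℚ b) ⟨
  ℚ.toℚᵘ (natℚ a) ℚᵘ.+ ℚ.toℚᵘ (natℚ b)
    ≈⟨ ℚP.toℚᵘ-homo-+ (natℚ a) (natℚ b) ⟨
  ℚ.toℚᵘ (natℚ a ℚ.+ natℚ b)
    ∎)
  where open ℚᵘP.≃-Reasoning

private
  cross-multiplied : ∀ x y c d → x * c ≡ suc y * d → (+ x ℤ.* + c) ℤ.* + 1 ≡ + d ℤ.* + (suc y * 1)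
  cross-multiplied x y c d xc≡[1+y]d = begin
    (+ x ℤ.* + c) ℤ.* + 1  ≡⟨ cong (ℤ._* + 1) (ℤP.pos-* x c) ⟨
    + (x * c) ℤ.* + 1      ≡⟨ cong (λ n → + n ℤ.* + 1) xc≡[1+y]d ⟩
    + (suc y * d) ℤ.* + 1  ≡⟨ ℤP.pos-* (suc y * d) 1 ⟨
    + (suc y * d * 1)      ≡⟨ cong +_ (ℕ-solve (y ∷ d ∷ [])) ⟩
    + (d * (suc y * 1))    ≡⟨ ℤP.pos-* d (suc y * 1) ⟩
    + d ℤ.* + (suc y * 1)  ∎
    where open ≡-Reasoning

natℚ-ratio : ∀ x y c d → x * c ≡ suc y * d → (+ x ℚ./ suc y) ℚ.* natℚ c ≡ natℚ d
natℚ-ratio x y c d xc≡[1+y]d = ℚP.toℚᵘ-injective (begin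
  ℚ.toℚᵘ ((+ x ℚ./ suc y) ℚ.* natℚ c)          ≈⟨ ℚP.toℚᵘ-homo-* (+ x ℚ./ suc y) (natℚ c) ⟩
  ℚ.toℚᵘ (+ x ℚ./ suc y) ℚᵘ.* ℚ.toℚᵘ (natℚ c)  ≈⟨ ℚᵘP.*-cong (ℚP.toℚᵘ-fromℚᵘ (mkℚᵘ (+ x) y)) (toℚᵘ-natℚ c) ⟩
  mkℚᵘ (+ x) y ℚᵘ.* mkℚᵘ (+ c) 0               ≈⟨ *≡* (cross-multiplied x y c d xc≡[1+y]d) ⟩
  mkℚᵘ (+ d) 0                                 ≈⟨ toℚᵘ-natℚ d ⟨
  ℚ.toℚᵘ (natℚ d)                              ∎)
  where open ℚᵘP.≃-Reasoning

sumTo-cong : ∀ n {f g : ℕ → ℚ} → (∀ k → k ≤ n → f k ≡ g k) → sumTo n f ≡ sumTo n g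
sumTo-cong zero    f≡g = f≡g 0 z≤n
sumTo-cong (suc n) f≡g = cong₂ ℚ._+_ (sumTo-cong n (λ k k≤n → f≡g k (m≤n⇒m≤1+n k≤n))) (f≡g (suc n) ≤-refl)

sumTo-front : ∀ n (f : ℕ → ℚ) → sumTo (suc n) f ≡ f 0 ℚ.+ sumTo n (f ∘ suc)
sumTo-front zero    f = refl
sumTo-front (suc n) f = trans (cong (ℚ._+ f (suc (suc n))) (sumTo-front n f)) (ℚP.+-assoc (f 0) _ _)

sumTo-*ˡ : ∀ n a (f : ℕ → ℚ) → sumTo n (λ k → a ℚ.* f k) ≡ a ℚ.* sumTo n f
sumTo-*ˡ zero    a f = refl
sumTo-*ˡ (suc n) a f = trans (cong (ℚ._+ (a ℚ.* f (suc n))) (sumTo-*ˡ n a f)) (sym (ℚP.*-distribˡ-+ a _ _))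

sumTo-+ : ∀ n (f g : ℕ → ℚ) → sumTo n (λ k → f k ℚ.+ g k) ≡ sumTo n f ℚ.+ sumTo n g
sumTo-+ zero    f g = refl
sumTo-+ (suc n) f g = trans (cong (ℚ._+ (f (suc n) ℚ.+ g (suc n))) (sumTo-+ n f g))
                            (interchange (sumTo n f) (sumTo n g) (f (suc n)) (g (suc n)))
  where open CommSemigroupProperties (CommutativeMonoid.commutativeSemigroup ℚP.+-0-commutativeMonoid)

*S-congʳ : ∀ f {g h} → g ≈S h → (f *S g) ≈S (f *S h)
*S-congʳ f g≈h n = sumTo-cong n (λ k _ → cong (f k ℚ.*_) (g≈h (n ∸ k)))

*S-congˡ : ∀ {f g} h → f ≈S g → (f *S h) ≈S (g *S h)
*S-congˡ h f≈g n = sumTo-cong n (λ k _ → cong (ℚ._* h (n ∸ k)) (f≈g k))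

mulCX-cong : ∀ c {f g} → f ≈S g → mulCX c f ≈S mulCX c g
mulCX-cong c f≈g zero    = refl
mulCX-cong c f≈g (suc n) = cong (c ℚ.*_) (f≈g n)

*S-suc : ∀ f g n → (f *S g) (suc n) ≡ (f *S (g ∘ suc)) n ℚ.+ f (suc n) ℚ.* g 0
*S-suc f g n = cong₂ ℚ._+_ (sumTo-cong n (λ k k≤n → cong (λ j → f k ℚ.* g j) (+-∸-assoc 1 k≤n)))
                           (cong (λ j → f (suc n) ℚ.* g j) (n∸n≡0 n))

*S-mulCXʳ : ∀ c f g → (f *S mulCX c g) ≈S mulCX c (f *S g)
*S-mulCXʳ c f g zero    = ℚP.*-zeroʳ (f 0)
*S-mulCXʳ c f g (suc n) = begin
  (f *S mulCX c g) (suc n)                                        ≡⟨ *S-suc f (mulCX c g) n ⟩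
  sumTo n (λ k → f k ℚ.* (c ℚ.* g (n ∸ k))) ℚ.+ f (suc n) ℚ.* 0ℚ  ≡⟨ cong₂ ℚ._+_ (sumTo-cong n (λ k _ → x∙yz≈y∙xz (f k) c _))
                                                                               (ℚP.*-zeroʳ (f (suc n))) ⟩
  sumTo n (λ k → c ℚ.* (f k ℚ.* g (n ∸ k))) ℚ.+ 0ℚ                ≡⟨ ℚP.+-identityʳ _ ⟩
  sumTo n (λ k → c ℚ.* (f k ℚ.* g (n ∸ k)))                       ≡⟨ sumTo-*ˡ n c _ ⟩
  c ℚ.* (f *S g) n                                                ∎
  where
  open ≡-Reasoning
  open CommSemigroupProperties (CommutativeMonoid.commutativeSemigroup ℚP.*-1-commutativeMonoid)
    using (x∙yz≈y∙xz)

ballotSeries : ℕ → Series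
ballotSeries r n = natℚ (ballot r n)

ballot-convolution : ∀ r → (ballotSeries r *S ballotSeries 1) ≈S ballotSeries (suc r)
ballot-convolution r zero = begin
  natℚ (ballot r 0) ℚ.* 1ℚ  ≡⟨ ℚP.*-identityʳ _ ⟩
  natℚ (ballot r 0)         ≡⟨ cong natℚ (ballot-zero r) ⟩
  1ℚ                        ∎
  where open ≡-Reasoning
ballot-convolution zero (suc n) = begin
  (B 0 *S B 1) (suc n)                                       ≡⟨ sumTo-front n _ ⟩
  1ℚ ℚ.* B 1 (suc n) ℚ.+ sumTo n (λ k → 0ℚ ℚ.* B 1 (n ∸ k))  ≡⟨ cong₂ ℚ._+_ (ℚP.*-identityˡ (B 1 (suc n))) vanish ⟩
  B 1 (suc n) ℚ.+ 0ℚ                                         ≡⟨ ℚP.+-identityʳ _ ⟩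
  B 1 (suc n)                                                ∎
  where
  open ≡-Reasoning
  B = ballotSeries
  vanish : sumTo n (λ k → 0ℚ ℚ.* B 1 (n ∸ k)) ≡ 0ℚ
  vanish = trans (sumTo-*ˡ n 0ℚ (λ k → B 1 (n ∸ k))) (ℚP.*-zeroˡ (sumTo n (λ k → B 1 (n ∸ k))))
ballot-convolution (suc r) (suc n) = begin
  (B (suc r) *S B 1) (suc n)
    ≡⟨ sumTo-front n _ ⟩
  B (suc r) 0 ℚ.* B 1 (suc n) ℚ.+ sumTo n (λ k → B (suc r) (suc k) ℚ.* B 1 (n ∸ k))
    ≡⟨ cong (B (suc r) 0 ℚ.* B 1 (suc n) ℚ.+_) (trans (sumTo-cong n (λ k _ → split k)) (sumTo-+ n _ _)) ⟩
  B (suc r) 0 ℚ.* B 1 (suc n) ℚ.+ (Σ₁ ℚ.+ (B (suc (suc r)) *S B 1) n)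
    ≡⟨ ℚP.+-assoc (B (suc r) 0 ℚ.* B 1 (suc n)) Σ₁ _ ⟨
  B (suc r) 0 ℚ.* B 1 (suc n) ℚ.+ Σ₁ ℚ.+ (B (suc (suc r)) *S B 1) n
    ≡⟨ cong (λ b → natℚ b ℚ.* B 1 (suc n) ℚ.+ Σ₁ ℚ.+ (B (suc (suc r)) *S B 1) n) (sym (ballot-zero r)) ⟩
  B r 0 ℚ.* B 1 (suc n) ℚ.+ Σ₁ ℚ.+ (B (suc (suc r)) *S B 1) n
    ≡⟨ cong (ℚ._+ (B (suc (suc r)) *S B 1) n) (sumTo-front n _) ⟨
  (B r *S B 1) (suc n) ℚ.+ (B (suc (suc r)) *S B 1) n
    ≡⟨ cong₂ ℚ._+_ (ballot-convolution r (suc n)) (ballot-convolution (suc (suc r)) n) ⟩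
  B (suc r) (suc n) ℚ.+ B (suc (suc (suc r))) n
    ≡⟨ natℚ-+ (ballot (suc r) (suc n)) _ ⟨
  B (suc (suc r)) (suc n)
    ∎
  where
  open ≡-Reasoning
  B = ballotSeries
  Σ₁ = sumTo n (λ k → B r (suc k) ℚ.* B 1 (n ∸ k))
  split : ∀ k → B (suc r) (suc k) ℚ.* B 1 (n ∸ k) ≡ B r (suc k) ℚ.* B 1 (n ∸ k) ℚ.+ B (suc (suc r)) k ℚ.* B 1 (n ∸ k)
  split k = trans (cong (ℚ._* B 1 (n ∸ k)) (natℚ-+ (ballot r (suc k)) _))
                  (ℚP.*-distribʳ-+ (B 1 (n ∸ k)) (B r (suc k)) _)

-- γ and θ as powers of the Catalan series

γ-ballot : ∀ m → γ m ≈S ballotSeries (suc (2 * m))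
γ-ballot m n = cong natℚ (𝒞-ballot n m)

θ-ballot : ∀ m → θ m ≈S ballotSeries (suc (suc (2 * m)))
θ-ballot m n = begin
  θ m n                                             ≡⟨ cong (λ N → weight ℚ.* natℚ (𝒞 N m)) (+-comm (n + m) 1) ⟩
  weight ℚ.* natℚ (𝒞 (suc n + m) m)                 ≡⟨ cong (λ b → weight ℚ.* natℚ b) (𝒞-ballot (suc n) m) ⟩
  weight ℚ.* natℚ (ballot (suc (2 * m)) (suc n))    ≡⟨ natℚ-ratio (suc n * suc m) (2 * m + (n + m) * suc (2 * m)) _ _
                                                                   (ballot-ratio-odd m n) ⟩
  natℚ (ballot (suc (suc (2 * m))) n)               ∎
  where
  open ≡-Reasoning
  weight = + (suc n * suc m) ℚ./ (suc (n + m) * suc (2 * m))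

γ₀-recurrence : ∀ n → (γ 0 *S γ 0) n ≡ γ 0 (suc n)
γ₀-recurrence n = begin
  (γ 0 *S γ 0) n                        ≡⟨ *S-congʳ (γ 0) (γ-ballot 0) n ⟩
  (γ 0 *S ballotSeries 1) n             ≡⟨ *S-congˡ (ballotSeries 1) (γ-ballot 0) n ⟩
  (ballotSeries 1 *S ballotSeries 1) n  ≡⟨ ballot-convolution 1 n ⟩
  ballotSeries 2 n                      ≡⟨ γ-ballot 0 (suc n) ⟨
  γ 0 (suc n)                           ∎
  where open ≡-Reasoning

-- The square root of 1 − 4x

private
  doubled-injective : ∀ x y z → x ℚ.+ x ℚ.+ z ≡ y ℚ.+ y ℚ.+ z → x ≡ y
  doubled-injective x y z eq = begin
    x                                ≡⟨ solve 2 (λ x z → x := con ℚ.½ :* ((x :+ x :+ z) :- z)) refl x z ⟩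
    ℚ.½ ℚ.* ((x ℚ.+ x ℚ.+ z) ℚ.- z)  ≡⟨ cong (λ w → ℚ.½ ℚ.* (w ℚ.- z)) eq ⟩
    ℚ.½ ℚ.* ((y ℚ.+ y ℚ.+ z) ℚ.- z)  ≡⟨ solve 2 (λ y z → con ℚ.½ :* ((y :+ y :+ z) :- z) := y) refl y z ⟩
    y                                ∎
    where
    open ≡-Reasoning
    open +-*-Solver

square-root-of-1-4x : ∀ {c s : Series} → c 0 ≡ 1ℚ → (∀ n → (c *S c) n ≡ c (suc n)) →
  s 0 ≡ 1ℚ → (s *S s) ≈S oneMinus4x → (constS 1ℚ -S s) ≈S mulCX (natℚ 2) c
square-root-of-1-4x {c} {s} c₀ c-rec s₀ s² = coefficients
  where
  open ≡-Reasoning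
  open +-*-Solver

  t u : ℕ → ℚ
  t = s ∘ suc
  u k = ℚ.- (natℚ 2 ℚ.* c k)

  four-products : ∀ a b → ℚ.- (natℚ 2 ℚ.* a) ℚ.* ℚ.- (natℚ 2 ℚ.* b) ≡ natℚ 4 ℚ.* (a ℚ.* b)
  four-products = solve 2 (λ a b → (:- (con (natℚ 2) :* a)) :* (:- (con (natℚ 2) :* b))
                                   := con (natℚ 4) :* (a :* b)) refl

  u-balance : ∀ k → u k ℚ.+ u k ℚ.+ natℚ 4 ℚ.* c k ≡ 0ℚ
  u-balance k = solve 1 (λ a → (:- (con (natℚ 2) :* a)) :+ (:- (con (natℚ 2) :* a)) :+ con (natℚ 4) :* a
                               := con 0ℚ) refl (c k)

  t≡u-if-balanced : ∀ k → t k ℚ.+ t k ℚ.+ natℚ 4 ℚ.* c k ≡ 0ℚ → t k ≡ u k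
  t≡u-if-balanced k balanced =
    doubled-injective (t k) (u k) (natℚ 4 ℚ.* c k) (trans balanced (sym (u-balance k)))

  u*u : ∀ n → (u *S u) n ≡ natℚ 4 ℚ.* c (suc n)
  u*u n = begin
    sumTo n (λ k → u k ℚ.* u (n ∸ k))               ≡⟨ sumTo-cong n (λ k _ → four-products (c k) (c (n ∸ k))) ⟩
    sumTo n (λ k → natℚ 4 ℚ.* (c k ℚ.* c (n ∸ k)))  ≡⟨ sumTo-*ˡ n (natℚ 4) _ ⟩
    natℚ 4 ℚ.* (c *S c) n                           ≡⟨ cong (natℚ 4 ℚ.*_) (c-rec n) ⟩
    natℚ 4 ℚ.* c (suc n)                            ∎

  s²-suc-suc : ∀ n → (s *S s) (suc (suc n)) ≡ t (suc n) ℚ.+ t (suc n) ℚ.+ (t *S t) n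
  s²-suc-suc n = begin
    (s *S s) (suc (suc n))
      ≡⟨ *S-suc s s (suc n) ⟩
    (s *S t) (suc n) ℚ.+ t (suc n) ℚ.* s 0
      ≡⟨ cong (ℚ._+ t (suc n) ℚ.* s 0) (sumTo-front n _) ⟩
    s 0 ℚ.* t (suc n) ℚ.+ (t *S t) n ℚ.+ t (suc n) ℚ.* s 0
      ≡⟨ cong (λ a → a ℚ.* t (suc n) ℚ.+ (t *S t) n ℚ.+ t (suc n) ℚ.* a) s₀ ⟩
    1ℚ ℚ.* t (suc n) ℚ.+ (t *S t) n ℚ.+ t (suc n) ℚ.* 1ℚ
      ≡⟨ solve 2 (λ x y → con 1ℚ :* x :+ y :+ x :* con 1ℚ := x :+ x :+ y) refl (t (suc n)) ((t *S t) n) ⟩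
    t (suc n) ℚ.+ t (suc n) ℚ.+ (t *S t) n
      ∎

  t₀≡u₀ : t 0 ≡ u 0
  t₀≡u₀ = t≡u-if-balanced 0 (begin
    t 0 ℚ.+ t 0 ℚ.+ natℚ 4 ℚ.* c 0              ≡⟨ solve 2 (λ x y → x :+ x :+ y := con 1ℚ :* x :+ x :* con 1ℚ :+ y)
                                                           refl (t 0) (natℚ 4 ℚ.* c 0) ⟩
    1ℚ ℚ.* t 0 ℚ.+ t 0 ℚ.* 1ℚ ℚ.+ natℚ 4 ℚ.* c 0  ≡⟨ cong₂ (λ a b → a ℚ.* t 0 ℚ.+ t 0 ℚ.* a ℚ.+ natℚ 4 ℚ.* b) (sym s₀) c₀ ⟩
    (s *S s) 1 ℚ.+ natℚ 4 ℚ.* 1ℚ                ≡⟨ cong (ℚ._+ natℚ 4 ℚ.* 1ℚ) (s² 1) ⟩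
    ℚ.- natℚ 4 ℚ.+ natℚ 4 ℚ.* 1ℚ                ≡⟨ solve 0 (:- con (natℚ 4) :+ con (natℚ 4) :* con 1ℚ := con 0ℚ) refl ⟩
    0ℚ                                          ∎)

  -- The coefficient of xⁿ⁺² in s² = 1 − 4x is 2 s(n+2) + Σ_{k≤n} s(k+1) s(n+1−k) = 0.
  t≡u-step : ∀ n → (∀ k → k ≤ n → t k ≡ u k) → t (suc n) ≡ u (suc n)
  t≡u-step n ih = t≡u-if-balanced (suc n) (begin
    t (suc n) ℚ.+ t (suc n) ℚ.+ natℚ 4 ℚ.* c (suc n)  ≡⟨ cong (t (suc n) ℚ.+ t (suc n) ℚ.+_) (trans t*t≡u*u (u*u n)) ⟨
    t (suc n) ℚ.+ t (suc n) ℚ.+ (t *S t) n            ≡⟨ s²-suc-suc n ⟨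
    (s *S s) (suc (suc n))                            ≡⟨ s² (suc (suc n)) ⟩
    0ℚ                                                ∎)
    where
    t*t≡u*u : (t *S t) n ≡ (u *S u) n
    t*t≡u*u = sumTo-cong n (λ k k≤n → cong₂ ℚ._*_ (ih k k≤n) (ih (n ∸ k) (m∸n≤m n k)))

  t≡u : ∀ n k → k ≤ n → t k ≡ u k
  t≡u zero    zero    _ = t₀≡u₀
  t≡u (suc n) k k≤1+n with m≤n⇒m<n∨m≡n k≤1+n
  ... | inj₁ k<1+n = t≡u n k (≤-pred k<1+n)
  ... | inj₂ refl  = t≡u-step n (t≡u n)

  coefficients : (constS 1ℚ -S s) ≈S mulCX (natℚ 2) c
  coefficients zero    = trans (cong (λ a → 1ℚ ℚ.- a) s₀) (ℚP.+-inverseʳ 1ℚ)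
  coefficients (suc n) = trans (cong (λ a → 0ℚ ℚ.- a) (t≡u n n ≤-refl))
                               (solve 1 (λ a → con 0ℚ :- (:- (con (natℚ 2) :* a)) := con (natℚ 2) :* a) refl (c n))

theorem7p2 : (m : ℕ) →
    (θ m ≈S (γ m *S γ 0)) ×
    ((s : Series) → s 0 ≡ 1ℚ → (s *S s) ≈S oneMinus4x →
      mulCX (natℚ 2) (θ m) ≈S (γ m *S (constS 1ℚ -S s)))
theorem7p2 m = θ≈γₘγ₀ , 2xθ≈γₘ[1-s]
  where
  open ≡-Reasoning
  θ≈γₘγ₀ : θ m ≈S (γ m *S γ 0)
  θ≈γₘγ₀ n = begin
    θ m n                                               ≡⟨ θ-ballot m n ⟩
    ballotSeries (suc (suc (2 * m))) n                  ≡⟨ ballot-convolution (suc (2 * m)) n ⟨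
    (ballotSeries (suc (2 * m)) *S ballotSeries 1) n    ≡⟨ *S-congˡ (ballotSeries 1) (γ-ballot m) n ⟨
    (γ m *S ballotSeries 1) n                           ≡⟨ *S-congʳ (γ m) (γ-ballot 0) n ⟨
    (γ m *S γ 0) n                                      ∎
  2xθ≈γₘ[1-s] : (s : Series) → s 0 ≡ 1ℚ → (s *S s) ≈S oneMinus4x →
                mulCX (natℚ 2) (θ m) ≈S (γ m *S (constS 1ℚ -S s))
  2xθ≈γₘ[1-s] s s₀ s² n = begin
    mulCX (natℚ 2) (θ m) n           ≡⟨ mulCX-cong (natℚ 2) θ≈γₘγ₀ n ⟩
    mulCX (natℚ 2) (γ m *S γ 0) n    ≡⟨ *S-mulCXʳ (natℚ 2) (γ m) (γ 0) n ⟨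
    (γ m *S mulCX (natℚ 2) (γ 0)) n  ≡⟨ *S-congʳ (γ m) 1-s≈2xγ₀ n ⟨
    (γ m *S (constS 1ℚ -S s)) n      ∎
    where
    1-s≈2xγ₀ : (constS 1ℚ -S s) ≈S mulCX (natℚ 2) (γ 0)
    1-s≈2xγ₀ = square-root-of-1-4x {γ 0} {s} (γ-ballot 0 0) γ₀-recurrence s₀ s²
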